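{- Let $A$ be an inhabited set with decidable equality, let $\mathcal A$ be the ideal completion of the poset $(A^*,\preceq)$ of finite sequences on $A$ ordered by prefix, and let $\iota:A^{\mathbb N}\to\mathcal A$ be $\iota(\alpha)=\{\tau\in A^*\mid \tau \text{ is an initial segment of }\alpha\}$. Then the image of $\iota$ is exactly the set of strongly maximal elements of $\mathcal A$.
   Context: We work constructively: informal set theory without excluded middle or choice. The ideal completion of $(A^*,\preceq)$ is the set of subsets $I\subseteq A^*$ that are lower sets for $\preceq$ and directed (inhabited, and any two elements of $I$ have a common extension in $I$), ordered by inclusion; it is an algebraic dcpo with directed suprema given by unions. In a dcpo, $x\ll y$ if for every directed $S$ with $y\sqsubseteq\bigsqcup S$ some $s\in S$ has $x\sqsubseteq s$. A subset $U$ is Scott open if it is an upper set and $\bigsqcup S\in U$ for directed $S$ implies some $s\in S$ lies in $U$. Two elements are Hausdorff separated if there are disjoint Scott open sets containing them respectively. An element $x$ is strongly maximal if for all $u\ll v$, either $u\ll x$ or $v$ and $x$ are Hausdorff separated. -}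

module Defs where

open import Data.Nat using (ℕ)
open import Data.List using (List; applyUpTo)
open import Data.List.Relation.Binary.Prefix.Heterogeneous as Prefix using (Prefix)
open import Data.Product using (Σ; ∃; _×_; _,_; proj₁; proj₂; Σ-syntax; ∃-syntax)
open import Data.Empty using (⊥)
open import Data.Sum using (_⊎_)
open import Data.Nat using (suc; zero; _≤_; z≤n; s≤s; _⊔_)
open import Data.Nat.Properties using (m≤m⊔n; m≤n⊔m)
open import Data.List using ([]; _∷_; length)
open import Relation.Binary.PropositionalEquality using (refl; cong; cong₂; sym; subst)
open import Function using (_∘_)
open import Relation.Binary.PropositionalEquality using (_≡_)

module _ (A : Set) where

  _⪯_ : List A → List A → Set
  σ ⪯ τ = Prefix _≡_ σ τ

  record Ideal : Set₁ where
    field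
      mem      : List A → Set
      lower    : ∀ {σ τ} → σ ⪯ τ → mem τ → mem σ
      inhabited : Σ[ τ ∈ List A ] mem τ
      directed : ∀ {σ τ} → mem σ → mem τ →
                 Σ[ ρ ∈ List A ] (mem ρ × σ ⪯ ρ × τ ⪯ ρ)
  open Ideal public

  _⊑_ : Ideal → Ideal → Set
  I ⊑ J = ∀ τ → mem I τ → mem J τ

  -- Directed families of ideals (a subset of 𝒜 is presented as a family
  -- indexed by a set K).
  record DirectedFamily : Set₁ where
    field
      Index   : Set
      elt     : Index → Ideal
      inh     : Index
      updir   : ∀ i j → Σ[ k ∈ Index ] (elt i ⊑ elt k × elt j ⊑ elt k)
  open DirectedFamily public

  ⨆ : DirectedFamily → Ideal
  mem (⨆ S) τ = Σ[ k ∈ Index S ] mem (elt S k) τ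
  lower (⨆ S) p (k , m) = k , lower (elt S k) p m
  inhabited (⨆ S) with inhabited (elt S (inh S))
  ... | τ , m = τ , (inh S , m)
  directed (⨆ S) {σ} {τ} (i , mi) (j , mj) with updir S i j
  ... | k , ik , jk with directed (elt S k) (ik σ mi) (jk τ mj)
  ... | ρ , mρ , p , q = ρ , (k , mρ) , p , q

  _≪_ : Ideal → Ideal → Set₁
  x ≪ y = (S : DirectedFamily) → y ⊑ ⨆ S → Σ[ k ∈ Index S ] (x ⊑ elt S k)

  record ScottOpen (U : Ideal → Set) : Set₁ where
    field
      upper : ∀ {x y} → x ⊑ y → U x → U y
      inacc : (S : DirectedFamily) → U (⨆ S) → Σ[ k ∈ Index S ] U (elt S k)

  HausdorffSeparated : Ideal → Ideal → Set₁
  HausdorffSeparated x y =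
    Σ[ U ∈ (Ideal → Set) ] Σ[ V ∈ (Ideal → Set) ]
      (ScottOpen U × ScottOpen V × U x × V y × (∀ z → U z → V z → ⊥))

  StronglyMaximal : Ideal → Set₁
  StronglyMaximal x = ∀ u v → u ≪ v → (u ≪ x) ⊎ HausdorffSeparated v x

  InitialSegment : List A → (ℕ → A) → Set
  InitialSegment τ α = Σ[ n ∈ ℕ ] (τ ≡ applyUpTo α n)

  private
    prefix-init : ∀ (α : ℕ → A) n σ → σ ⪯ applyUpTo α n →
                  σ ≡ applyUpTo α (length σ)
    prefix-init α n [] p = refl
    prefix-init α (suc n) (a ∷ σ) (refl Prefix.∷ p) =
      cong (α zero ∷_) (prefix-init (α ∘ suc) n σ p)

    init-mono : ∀ (α : ℕ → A) {n m} → n ≤ m → applyUpTo α n ⪯ applyUpTo α m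
    init-mono α z≤n = Prefix.[]
    init-mono α (s≤s p) = refl Prefix.∷ init-mono (α ∘ suc) p

  ι : (ℕ → A) → Ideal
  mem (ι α) τ = InitialSegment τ α
  lower (ι α) {σ} p (n , refl) = length σ , prefix-init α n σ p
  inhabited (ι α) = applyUpTo α zero , zero , refl
  directed (ι α) (n , refl) (m , refl) =
    applyUpTo α (n ⊔ m) , (n ⊔ m , refl) , init-mono α (m≤m⊔n n m) , init-mono α (m≤n⊔m n m)

  -- x lies in the image of ι (equality of ideals = mutual inclusion).
  InImageι : Ideal → Set
  InImageι x = Σ[ α ∈ (ℕ → A) ] (ι α ⊑ x × x ⊑ ι α)

-- Everything reduces to principal ideals: ↓τ is way below x exactly when
-- τ ∈ x, every u ≪ v lies below some ↓τ with τ ∈ v, and two ideals containing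
-- distinct sequences of the same length are separated by the Scott opens
-- "contains τ".  For x = ι α, decidable equality compares τ with the initial
-- segment of α of length |τ|: if they agree then u ≪ x, otherwise v and x are
-- separated.  Conversely, for strongly maximal x and τ ∈ x, test the definition
-- on ↓(τ ∷ʳ a) ≪ ↓(τ ∷ʳ a): either τ ∷ʳ a ∈ x, or some σ ∈ x has ↓σ in an open
-- set avoiding ↓(τ ∷ʳ a), which forces a common extension of σ and τ in x to be
-- strictly longer than τ.  Hence x is closed under one-step extension, and
-- iterating from [] yields α with x = ι α.
module Submission where

open import Defs hiding (_⪯_; _⊑_; _≪_)
import Defs
open import Relation.Binary.Definitions using (DecidableEquality)
open import Function.Bundles using (_⇔_; mk⇔)
open import Data.Nat using (ℕ; zero; suc)
open import Data.Nat.Properties using (suc-injective)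
open import Data.List using (List; []; _∷_; [_]; length; applyUpTo; _∷ʳ_)
open import Data.List.Properties using (length-applyUpTo; applyUpTo-∷ʳ; ≡-dec)
open import Data.List.Relation.Binary.Prefix.Heterogeneous using ([]; _∷_; _++ᵖ_)
import Data.List.Relation.Binary.Prefix.Heterogeneous.Properties as Prefix
import Data.List.Relation.Binary.Pointwise.Properties as Pointwise
open import Data.Product using (Σ; _×_; _,_; proj₁; proj₂; Σ-syntax)
open import Data.Sum using (_⊎_; inj₁; inj₂)
open import Data.Empty using (⊥-elim)
open import Relation.Nullary using (yes; no)
open import Relation.Binary.PropositionalEquality as ≡ using (_≡_; _≢_; refl; sym; cong; subst)

module IdealCompletion (A : Set) where

  infix 4 _⪯_ _⊑_ _≪_

  _⪯_ : List A → List A → Set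
  _⪯_ = Defs._⪯_ A

  _⊑_ : Ideal A → Ideal A → Set
  _⊑_ = Defs._⊑_ A

  _≪_ : Ideal A → Ideal A → Set₁
  _≪_ = Defs._≪_ A

  ⪯-refl : ∀ σ → σ ⪯ σ
  ⪯-refl σ = Prefix.fromPointwise (Pointwise.refl refl)

  ⪯-trans : ∀ {σ τ ρ} → σ ⪯ τ → τ ⪯ ρ → σ ⪯ ρ
  ⪯-trans = Prefix.trans ≡.trans

  ⪯-∷ʳ : ∀ σ b → σ ⪯ σ ∷ʳ b
  ⪯-∷ʳ σ b = ⪯-refl σ ++ᵖ [ b ]

  ⪯-common-equal-length⇒≡ : ∀ {σ τ ρ} → σ ⪯ ρ → τ ⪯ ρ → length σ ≡ length τ → σ ≡ τ
  ⪯-common-equal-length⇒≡ []           []           _   = refl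
  ⪯-common-equal-length⇒≡ (refl ∷ σ⪯ρ) (refl ∷ τ⪯ρ) len =
    cong (_ ∷_) (⪯-common-equal-length⇒≡ σ⪯ρ τ⪯ρ (suc-injective len))

  ⪯⇒≡⊎∷ʳ⪯ : ∀ {τ ρ} → τ ⪯ ρ → ρ ≡ τ ⊎ Σ[ b ∈ A ] τ ∷ʳ b ⪯ ρ
  ⪯⇒≡⊎∷ʳ⪯ {ρ = []}    []    = inj₁ refl
  ⪯⇒≡⊎∷ʳ⪯ {ρ = c ∷ _} []    = inj₂ (c , refl ∷ [])
  ⪯⇒≡⊎∷ʳ⪯ (refl ∷ τ⪯ρ) with ⪯⇒≡⊎∷ʳ⪯ τ⪯ρ
  ... | inj₁ ρ≡τ      = inj₁ (cong (_ ∷_) ρ≡τ)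
  ... | inj₂ (b , ext) = inj₂ (b , refl ∷ ext)

  []∈ : ∀ (I : Ideal A) → mem I []
  []∈ I = lower I [] (proj₂ (inhabited I))

  ∈-equal-length⇒≡ : ∀ (I : Ideal A) {σ τ} → mem I σ → mem I τ → length σ ≡ length τ → σ ≡ τ
  ∈-equal-length⇒≡ I σ∈I τ∈I len with directed I σ∈I τ∈I
  ... | _ , _ , σ⪯ρ , τ⪯ρ = ⪯-common-equal-length⇒≡ σ⪯ρ τ⪯ρ len

  ↓_ : List A → Ideal A
  mem (↓ w) σ = σ ⪯ w
  lower (↓ w) = ⪯-trans
  inhabited (↓ w) = [] , []
  directed (↓ w) σ⪯w τ⪯w = w , ⪯-refl w , σ⪯w , τ⪯w

  ↓-mono : ∀ {σ τ} → σ ⪯ τ → ↓ σ ⊑ ↓ τ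
  ↓-mono σ⪯τ _ ρ⪯σ = ⪯-trans ρ⪯σ σ⪯τ

  ↓-least : ∀ {w} (I : Ideal A) → mem I w → ↓ w ⊑ I
  ↓-least I w∈I _ σ⪯w = lower I σ⪯w w∈I

  ↓-compact : ∀ {w} (I : Ideal A) → mem I w → ↓ w ≪ I
  ↓-compact I w∈I S I⊑⨆S with I⊑⨆S _ w∈I
  ... | k , w∈Sk = k , ↓-least (elt S k) w∈Sk

  principalsBelow : Ideal A → DirectedFamily A
  Index (principalsBelow I) = Σ (List A) (mem I)
  elt (principalsBelow I) (w , _) = ↓ w
  inh (principalsBelow I) = inhabited I
  updir (principalsBelow I) (_ , σ∈I) (_ , τ∈I) with directed I σ∈I τ∈I
  ... | ρ , ρ∈I , σ⪯ρ , τ⪯ρ = (ρ , ρ∈I) , ↓-mono σ⪯ρ , ↓-mono τ⪯ρ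

  ⊑⨆principalsBelow : ∀ I → I ⊑ ⨆ A (principalsBelow I)
  ⊑⨆principalsBelow I τ τ∈I = (τ , τ∈I) , ⪯-refl τ

  ≪⇒⊑principal : ∀ {u v} → u ≪ v → Σ[ τ ∈ List A ] (mem v τ × u ⊑ ↓ τ)
  ≪⇒⊑principal {v = v} u≪v with u≪v (principalsBelow v) (⊑⨆principalsBelow v)
  ... | (τ , τ∈v) , u⊑↓τ = τ , τ∈v , u⊑↓τ

  ≪⇒⊑ : ∀ {u v} → u ≪ v → u ⊑ v
  ≪⇒⊑ {u} {v} u≪v σ σ∈u with ≪⇒⊑principal {u} {v} u≪v
  ... | τ , τ∈v , u⊑↓τ = lower v (u⊑↓τ σ σ∈u) τ∈v

  ⊑-≪-trans : ∀ {u w x} → u ⊑ w → w ≪ x → u ≪ x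
  ⊑-≪-trans u⊑w w≪x S x⊑⨆S with w≪x S x⊑⨆S
  ... | k , w⊑Sk = k , λ σ σ∈u → w⊑Sk σ (u⊑w σ σ∈u)

  ∋-open : ∀ τ → ScottOpen A (λ I → mem I τ)
  ∋-open τ = record { upper = λ I⊑J τ∈I → I⊑J τ τ∈I ; inacc = λ _ τ∈⨆S → τ∈⨆S }

  open⇒principal∈ : ∀ {V x} → ScottOpen A V → V x → Σ[ σ ∈ List A ] (mem x σ × V (↓ σ))
  open⇒principal∈ {x = x} V-open Vx
    with ScottOpen.inacc V-open (principalsBelow x)
           (ScottOpen.upper V-open (⊑⨆principalsBelow x) Vx)
  ... | (σ , σ∈x) , V↓σ = σ , σ∈x , V↓σ

  separated-by-equal-length : ∀ {σ τ y z} → σ ≢ τ → length σ ≡ length τ →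
                              mem y σ → mem z τ → HausdorffSeparated A y z
  separated-by-equal-length {σ} {τ} σ≢τ len σ∈y τ∈z =
    (λ I → mem I σ) , (λ I → mem I τ) , ∋-open σ , ∋-open τ , σ∈y , τ∈z ,
    λ I σ∈I τ∈I → σ≢τ (∈-equal-length⇒≡ I σ∈I τ∈I len)

  ι⊑⇒stronglyMaximal : DecidableEquality A → ∀ α {x} → ι A α ⊑ x → StronglyMaximal A x
  ι⊑⇒stronglyMaximal _≟_ α {x} ια⊑x u v u≪v
    with ≪⇒⊑principal {u} {v} u≪v
  ... | τ , τ∈v , u⊑↓τ with ≡-dec _≟_ τ (applyUpTo α (length τ))
  ... | yes τ≡α↾ = inj₁ (⊑-≪-trans {u} {↓ τ} {x} u⊑↓τ (↓-compact {τ} x (ια⊑x τ (length τ , τ≡α↾))))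
  ... | no  τ≢α↾ = inj₂ (separated-by-equal-length τ≢α↾
                          (sym (length-applyUpTo α (length τ))) τ∈v (ια⊑x _ (length τ , refl)))

  stronglyMaximal⇒∷ʳ∈ : A → ∀ {x} → StronglyMaximal A x →
                        ∀ {τ} → mem x τ → Σ[ b ∈ A ] mem x (τ ∷ʳ b)
  stronglyMaximal⇒∷ʳ∈ a {x} sm {τ} τ∈x
    with sm (↓ (τ ∷ʳ a)) (↓ (τ ∷ʳ a)) (↓-compact (↓ (τ ∷ʳ a)) (⪯-refl (τ ∷ʳ a)))
  ... | inj₁ w≪x = a , ≪⇒⊑ {↓ (τ ∷ʳ a)} {x} w≪x _ (⪯-refl (τ ∷ʳ a))
  ... | inj₂ (U , V , _ , V-open , U↓w , Vx , disjoint)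
    with open⇒principal∈ V-open Vx
  ... | σ , σ∈x , V↓σ with directed x σ∈x τ∈x
  ... | ρ , ρ∈x , σ⪯ρ , τ⪯ρ with ⪯⇒≡⊎∷ʳ⪯ τ⪯ρ
  ... | inj₂ (b , τb⪯ρ) = b , lower x τb⪯ρ ρ∈x
  ... | inj₁ refl = ⊥-elim (disjoint (↓ (τ ∷ʳ a)) U↓w
                      (ScottOpen.upper V-open (↓-mono (⪯-trans σ⪯ρ (⪯-∷ʳ τ a))) V↓σ))

  module _ (x : Ideal A) (extend : ∀ {τ} → mem x τ → Σ[ b ∈ A ] mem x (τ ∷ʳ b)) where

    chain : ℕ → Σ (List A) (mem x)
    chain zero    = [] , []∈ x
    chain (suc n) with chain n
    ... | τ , τ∈x = τ ∷ʳ proj₁ (extend τ∈x) , proj₂ (extend τ∈x)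

    limit : ℕ → A
    limit n = proj₁ (extend (proj₂ (chain n)))

    chain≡applyUpTo : ∀ n → proj₁ (chain n) ≡ applyUpTo limit n
    chain≡applyUpTo zero    = refl
    chain≡applyUpTo (suc n) = ≡.trans (cong (_∷ʳ limit n) (chain≡applyUpTo n)) (applyUpTo-∷ʳ limit n)

    ∷ʳ-closed⇒inImageι : InImageι A x
    ∷ʳ-closed⇒inImageι = limit , ιlimit⊑x , x⊑ιlimit
      where
        ιlimit⊑x : ι A limit ⊑ x
        ιlimit⊑x _ (n , refl) = subst (mem x) (chain≡applyUpTo n) (proj₂ (chain n))

        x⊑ιlimit : x ⊑ ι A limit
        x⊑ιlimit τ τ∈x = length τ , ≡.trans τ≡chain (chain≡applyUpTo (length τ))
          where
            τ≡chain : τ ≡ proj₁ (chain (length τ))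
            τ≡chain = ∈-equal-length⇒≡ x τ∈x (proj₂ (chain (length τ)))
              (sym (≡.trans (cong length (chain≡applyUpTo (length τ))) (length-applyUpTo limit (length τ))))

open IdealCompletion

theorem7p4 : (A : Set) → DecidableEquality A → A →
    (x : Ideal A) → InImageι A x ⇔ StronglyMaximal A x
theorem7p4 A _≟_ a x = mk⇔ inImage⇒stronglyMaximal stronglyMaximal⇒inImage
  where
    inImage⇒stronglyMaximal : InImageι A x → StronglyMaximal A x
    inImage⇒stronglyMaximal (α , ια⊑x , _) = ι⊑⇒stronglyMaximal A _≟_ α ια⊑x

    stronglyMaximal⇒inImage : StronglyMaximal A x → InImageι A x
    stronglyMaximal⇒inImage sm = ∷ʳ-closed⇒inImageι A x (stronglyMaximal⇒∷ʳ∈ A a sm)
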